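{- Let $n\ge1$ and $k\ge 0$ with $2k\le 3n$, let $s$ be the sign string consisting of $k$ minuses followed by $3n-2k$ pluses, and let $T_s$ be a filling of content $s$. Then $(2i-1,2i)\in\tau(\widetilde{T_s}')$ for all $1\le i\le k$.
   Context: A sign string is a finite word in $\{+,-\}$. A filling of content $s$ is a semistandard Young tableau (entries weakly increasing along rows and strictly increasing down columns) of shape $(3,3,\dots,3)$ with $n$ rows, in which each of $1,\dots,k$ appears exactly twice and each of $k+1,\dots,3n-k$ appears exactly once. From $T_s$ one constructs the standard tableau $\widetilde{T_s}$ of the same shape by replacing, for each $i\le k$, the leftmost occurrence of $i$ by $2i-1$ and the rightmost occurrence by $2i$, and replacing each $i>k$ by $i+k$. For a tableau $T$, $T'$ denotes its conjugate (transpose), so $\widetilde{T_s}'$ is a standard tableau of shape $(n,n,n)$. For a tableau $T$, $\tau(T)$ is the set of pairs $(i,i+1)$ such that $i$ lies in a row strictly above the row containing $i+1$. -}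

module Defs where

open import Data.Nat using (ℕ; zero; suc; _+_; _*_; _∸_; _≤_; _<_; _≡ᵇ_; _<ᵇ_; _≤ᵇ_)
open import Data.Fin using (Fin; toℕ)
open import Data.List using (List; map)
open import Data.Nat.ListAction using (sum)
open import Data.Bool.ListAction using (any)
open import Data.Bool using (Bool; true; false; if_then_else_; _∧_)
open import Data.Product using (_×_; _,_; ∃)
open import Relation.Binary.PropositionalEquality using (_≡_)
open import Data.List using () renaming (allFin to allFinL)

-- A tableau of rectangular shape (b,b,...,b) with a rows: T r c is the
-- entry in row r (0 = top) and column c (0 = left).
Tableau : ℕ → ℕ → Set
Tableau a b = Fin a → Fin b → ℕ

IsSSYT : ∀ {a b} → Tableau a b → Set
IsSSYT {a} {b} T =
  (∀ (r : Fin a) (c c′ : Fin b) → toℕ c < toℕ c′ → T r c ≤ T r c′) ×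
  (∀ (r r′ : Fin a) (c : Fin b) → toℕ r < toℕ r′ → T r c < T r′ c)

count : ∀ {a b} → Tableau a b → ℕ → ℕ
count {a} {b} T v =
  sum (map (λ r → sum (map (λ c → if T r c ≡ᵇ v then 1 else 0) (allFinL b))) (allFinL a))

-- T is a filling of content s, where s has k minuses (shape (3,...,3), n rows):
-- each of 1..k appears exactly twice, each of k+1..3n-k exactly once.
IsFilling : (n k : ℕ) → Tableau n 3 → Set
IsFilling n k T =
  IsSSYT T ×
  (∀ v → 1 ≤ v → v ≤ k → count T v ≡ 2) ×
  (∀ v → k < v → v ≤ 3 * n ∸ k → count T v ≡ 1)

occursLeft : ∀ {a b} → Tableau a b → Fin a → Fin b → Bool
occursLeft {a} {b} T r c =
  any (λ r′ → any (λ c′ → (T r′ c′ ≡ᵇ T r c) ∧ (toℕ c′ <ᵇ toℕ c)) (allFinL b)) (allFinL a)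

-- The standardization T̃: for i ≤ k the leftmost occurrence of i becomes
-- 2i-1, the rightmost becomes 2i; each i > k becomes i + k.
tilde : ∀ {a b} → ℕ → Tableau a b → Tableau a b
tilde k T r c =
  if T r c ≤ᵇ k
  then (if occursLeft T r c then 2 * T r c else 2 * T r c ∸ 1)
  else T r c + k

conj : ∀ {a b} → Tableau a b → Tableau b a
conj T c r = T r c

_∈τ_ : ∀ {a b} → ℕ × ℕ → Tableau a b → Set
_∈τ_ {a} {b} (i , j) T =
  j ≡ suc i ×
  ∃ λ (r : Fin a) → ∃ λ (c : Fin b) → ∃ λ (r′ : Fin a) → ∃ λ (c′ : Fin b) →
    T r c ≡ i × T r′ c′ ≡ suc i × toℕ r < toℕ r′

-- Strictly increasing columns contain each value at most once, so the two copies of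
-- i ≤ k lie in distinct columns c < c′, with no copy of i left of column c. Hence the
-- copy in column c becomes 2i - 1 in T̃ and the copy in column c′ becomes 2i; in the
-- conjugate these sit in rows c and c′.
module Submission where

open import Defs
open import Data.Nat using (ℕ; _+_; _*_; _∸_; _≤_)
open import Data.Product using (_,_)

open import Data.Nat using (zero; suc; _<_; _≡ᵇ_; _<ᵇ_; z≤n; s≤s; s≤s⁻¹)
open import Data.Nat.Properties
  using (+-0-commutativeMonoid; _≟_; ≡ᵇ⇒≡; ≡⇒≡ᵇ; <ᵇ⇒<; <⇒<ᵇ; ≤⇒≤ᵇ; ≤-refl; <⇒≢; m+n≡0⇒m≡0; m+n≡0⇒n≡0)
import Data.Nat.ListAction as List
open import Algebra.Properties.CommutativeMonoid.Sum +-0-commutativeMonoid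
  using (sum-syntax; sum-cong-≋; ∑-comm)
open import Data.Bool using (Bool; true; false; if_then_else_; _∧_)
open import Data.Bool.Properties using (T-≡; T-∧)
open import Data.Bool.ListAction using (any)
open import Data.Fin using (Fin; zero; suc; toℕ)
open import Data.Fin.Properties using (<-cmp; suc-injective; 0≢1+n)
open import Data.List using (map; tabulate; allFin)
open import Data.List.Properties using (map-tabulate)
open import Data.List.Membership.Propositional using (lose)
open import Data.List.Membership.Propositional.Properties using (∈-allFin)
open import Data.List.Relation.Unary.Any using (satisfied)
open import Data.List.Relation.Unary.Any.Properties using (any⁺; any⁻)
open import Data.Product using (∃; ∃₂; _×_)
open import Data.Vec.Functional using (Vector)
open import Function using (_∘_; Equivalence)
open import Function.Definitions using (Injective)
open import Relation.Binary.Definitions using (tri<; tri≈; tri>)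
open import Relation.Binary.PropositionalEquality
open import Relation.Nullary using (contradiction; yes; no)

sum-tabulate : ∀ {n} (f : Vector ℕ n) → List.sum (tabulate f) ≡ ∑[ i < n ] f i
sum-tabulate {zero}  f = refl
sum-tabulate {suc n} f = cong (f zero +_) (sum-tabulate (f ∘ suc))

sum-allFin : ∀ {n} (f : Vector ℕ n) → List.sum (map f (allFin n)) ≡ ∑[ i < n ] f i
sum-allFin f = trans (cong List.sum (map-tabulate (λ i → i) f)) (sum-tabulate f)

δ : ℕ → ℕ → ℕ
δ u v = if u ≡ᵇ v then 1 else 0

δ-pos⇒≡ : ∀ u v → 1 ≤ δ u v → u ≡ v
δ-pos⇒≡ u v p with u ≡ᵇ v in eq
... | true = ≡ᵇ⇒≡ u v (Equivalence.from T-≡ eq)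

δ-refl : ∀ v → δ v v ≡ 1
δ-refl v rewrite Equivalence.to T-≡ (≡⇒≡ᵇ v v refl) = refl

δ-≢ : ∀ {u v} → u ≢ v → δ u v ≡ 0
δ-≢ {u} {v} u≢v with u ≡ᵇ v in eq
... | true  = contradiction (≡ᵇ⇒≡ u v (Equivalence.from T-≡ eq)) u≢v
... | false = refl

∑-pos⇒∃-pos : ∀ {n} (f : Vector ℕ n) → 1 ≤ ∑[ i < n ] f i → ∃ λ i → 1 ≤ f i
∑-pos⇒∃-pos {suc n} f p with f zero in eq
... | suc _ = zero , subst (1 ≤_) (sym eq) (s≤s z≤n)
... | zero  = let i , q = ∑-pos⇒∃-pos (f ∘ suc) p in suc i , q

∑≡0⇒≡0 : ∀ {n} (f : Vector ℕ n) → ∑[ i < n ] f i ≡ 0 → ∀ i → f i ≡ 0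
∑≡0⇒≡0 f p zero    = m+n≡0⇒m≡0 (f zero) p
∑≡0⇒≡0 f p (suc i) = ∑≡0⇒≡0 (f ∘ suc) (m+n≡0⇒n≡0 (f zero) p) i

occurrences : ∀ {a} → Vector ℕ a → ℕ → ℕ
occurrences {a} g v = ∑[ r < a ] δ (g r) v

occurrences-pos⇒∈ : ∀ {a} (g : Vector ℕ a) v → 1 ≤ occurrences g v → ∃ λ r → g r ≡ v
occurrences-pos⇒∈ g v p = let r , q = ∑-pos⇒∃-pos _ p in r , δ-pos⇒≡ (g r) v q

occurrences≡0⇒∉ : ∀ {a} (g : Vector ℕ a) v → occurrences g v ≡ 0 → ∀ r → g r ≢ v
occurrences≡0⇒∉ g v p r refl with () ← trans (sym (δ-refl v)) (∑≡0⇒≡0 _ p r)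

∉⇒occurrences≡0 : ∀ {a} (g : Vector ℕ a) v → (∀ r → g r ≢ v) → occurrences g v ≡ 0
∉⇒occurrences≡0 {zero}  g v g∌v = refl
∉⇒occurrences≡0 {suc a} g v g∌v =
  cong₂ _+_ (δ-≢ (g∌v zero)) (∉⇒occurrences≡0 (g ∘ suc) v (g∌v ∘ suc))

occurrences-injective≤1 : ∀ {a} (g : Vector ℕ a) v → Injective _≡_ _≡_ g → occurrences g v ≤ 1
occurrences-injective≤1 {zero}  g v inj = z≤n
occurrences-injective≤1 {suc a} g v inj with g zero ≟ v
... | yes refl rewrite δ-refl (g zero)
                     | ∉⇒occurrences≡0 (g ∘ suc) (g zero) (λ r eq → 0≢1+n (inj (sym eq)))
                     = s≤s z≤n
... | no g₀≢v rewrite δ-≢ g₀≢v = occurrences-injective≤1 (g ∘ suc) v (suc-injective ∘ inj)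

leftmost-two-pos : ∀ {n} (f : Vector ℕ n) → (∀ i → f i ≤ 1) → 2 ≤ ∑[ i < n ] f i →
  ∃₂ λ i j → toℕ i < toℕ j × 1 ≤ f i × 1 ≤ f j × (∀ h → toℕ h < toℕ i → f h ≡ 0)
leftmost-two-pos {suc n} f f≤1 p with f zero in eq | f≤1 zero
... | suc (suc _) | s≤s ()
... | suc zero | _ =
  let j , q = ∑-pos⇒∃-pos (f ∘ suc) (s≤s⁻¹ p)
  in zero , suc j , s≤s z≤n , subst (1 ≤_) (sym eq) (s≤s z≤n) , q , λ _ ()
... | zero | _ =
  let i , j , i<j , pᵢ , pⱼ , left = leftmost-two-pos (f ∘ suc) (f≤1 ∘ suc) p
  in suc i , suc j , s≤s i<j , pᵢ , pⱼ , λ where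
       zero    _         → eq
       (suc h) (s≤s h<i) → left h h<i

column : ∀ {a b} → Tableau a b → Fin b → Vector ℕ a
column T c r = T r c

count-by-columns : ∀ {a b} (T : Tableau a b) v → count T v ≡ ∑[ c < b ] occurrences (column T c) v
count-by-columns {a} {b} T v = begin
  count T v
    ≡⟨ sum-allFin {a} _ ⟩
  ∑[ r < a ] List.sum (map (λ c → δ (T r c) v) (allFin b))
    ≡⟨ sum-cong-≋ {a} (λ r → sum-allFin {b} _) ⟩
  ∑[ r < a ] ∑[ c < b ] δ (T r c) v
    ≡⟨ ∑-comm {a} {b} _ ⟩
  ∑[ c < b ] ∑[ r < a ] δ (T r c) v
    ∎
  where open ≡-Reasoning

strictlyIncreasing⇒injective : ∀ {a} (g : Vector ℕ a) →
  (∀ r r′ → toℕ r < toℕ r′ → g r < g r′) → Injective _≡_ _≡_ g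
strictlyIncreasing⇒injective g incr {r} {r′} eq with <-cmp r r′
... | tri< r<r′ _ _ = contradiction eq (<⇒≢ (incr r r′ r<r′))
... | tri≈ _ r≡r′ _ = r≡r′
... | tri> _ _ r′<r = contradiction (sym eq) (<⇒≢ (incr r′ r r′<r))

IsColumnStrict : ∀ {a b} → Tableau a b → Set
IsColumnStrict {a} {b} T = ∀ (r r′ : Fin a) (c : Fin b) → toℕ r < toℕ r′ → T r c < T r′ c

column-occurrences≤1 : ∀ {a b} (T : Tableau a b) → IsColumnStrict T →
  ∀ v c → occurrences (column T c) v ≤ 1
column-occurrences≤1 T colStrict v c = occurrences-injective≤1 (column T c) v
  (strictlyIncreasing⇒injective (column T c) (λ r r′ → colStrict r r′ c))

record LeftmostTwoOccurrences {a b} (T : Tableau a b) (v : ℕ) : Set where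
  field
    row row′           : Fin a
    col col′           : Fin b
    first≡v            : T row col ≡ v
    second≡v           : T row′ col′ ≡ v
    col<col′           : toℕ col < toℕ col′
    none-left-of-first : ∀ r c → toℕ c < toℕ col → T r c ≢ v

leftmostTwoOccurrences : ∀ {a b} (T : Tableau a b) → IsColumnStrict T →
  ∀ v → count T v ≡ 2 → LeftmostTwoOccurrences T v
leftmostTwoOccurrences T colStrict v twice
  with leftmost-two-pos _ (column-occurrences≤1 T colStrict v)
         (subst (2 ≤_) (trans (sym twice) (count-by-columns T v)) ≤-refl)
... | c , c′ , c<c′ , pos , pos′ , left
  with occurrences-pos⇒∈ _ v pos | occurrences-pos⇒∈ _ v pos′
... | r , Trc≡v | r′ , Tr′c′≡v = record
  { row = r
  ; row′ = r′
  ; col = c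
  ; col′ = c′
  ; first≡v = Trc≡v
  ; second≡v = Tr′c′≡v
  ; col<col′ = c<c′
  ; none-left-of-first = λ r″ c″ c″<c → occurrences≡0⇒∉ (column T c″) v (left c″ c″<c) r″
  }

occursLeft-complete : ∀ {a b} (T : Tableau a b) {r c r′ c′} →
  T r′ c′ ≡ T r c → toℕ c′ < toℕ c → occursLeft T r c ≡ true
occursLeft-complete T {r′ = r′} {c′} eq c′<c = Equivalence.to T-≡
  (any⁺ _ (lose (∈-allFin r′) (any⁺ _ (lose (∈-allFin c′)
    (Equivalence.from T-∧ (≡⇒≡ᵇ _ _ eq , <⇒<ᵇ c′<c))))))

occursLeft-sound : ∀ {a b} (T : Tableau a b) {r c} → occursLeft T r c ≡ true →
  ∃₂ λ r′ c′ → T r′ c′ ≡ T r c × toℕ c′ < toℕ c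
occursLeft-sound {a} {b} T {r} {c} found =
  let r′ , inRow = satisfied (any⁻ (λ r′ → any (hit r′) (allFin b)) (allFin a) (Equivalence.from T-≡ found))
      c′ , cell  = satisfied (any⁻ (hit r′) (allFin b) inRow)
      eq , c′<c  = Equivalence.to T-∧ cell
  in r′ , c′ , ≡ᵇ⇒≡ _ _ eq , <ᵇ⇒< _ _ c′<c
  where
  hit : Fin a → Fin b → Bool
  hit r′ c′ = (T r′ c′ ≡ᵇ T r c) ∧ (toℕ c′ <ᵇ toℕ c)

tilde-≤ : ∀ {a b} k (T : Tableau a b) r c → T r c ≤ k →
  tilde k T r c ≡ (if occursLeft T r c then 2 * T r c else 2 * T r c ∸ 1)
tilde-≤ k T r c Trc≤k rewrite Equivalence.to T-≡ (≤⇒≤ᵇ Trc≤k) = refl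

tilde-first : ∀ {a b} k (T : Tableau a b) {r c v} → T r c ≡ v → v ≤ k →
  (∀ r′ c′ → toℕ c′ < toℕ c → T r′ c′ ≢ v) → tilde k T r c ≡ 2 * v ∸ 1
tilde-first k T {r} {c} refl v≤k leftmost rewrite tilde-≤ k T r c v≤k with occursLeft T r c in found
... | false = refl
... | true  = let r′ , c′ , eq , c′<c = occursLeft-sound T found in contradiction eq (leftmost r′ c′ c′<c)

tilde-later : ∀ {a b} k (T : Tableau a b) {r c r′ c′ v} → T r′ c′ ≡ v → T r c ≡ v → v ≤ k →
  toℕ c′ < toℕ c → tilde k T r c ≡ 2 * v
tilde-later k T {r} {c} eq′ refl v≤k c′<c
  rewrite tilde-≤ k T r c v≤k | occursLeft-complete T eq′ c′<c = refl

∈τ-conj-tilde : ∀ {a b} k (T : Tableau a b) i → 1 ≤ i → i ≤ k →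
  LeftmostTwoOccurrences T i → (2 * i ∸ 1 , 2 * i) ∈τ conj (tilde k T)
-- For i = suc j the side condition 2 * i ≡ suc (2 * i ∸ 1) holds by computation.
∈τ-conj-tilde k T (suc _) _ i≤k occ =
  refl , col , row , col′ , row′ ,
  tilde-first k T first≡v i≤k none-left-of-first ,
  tilde-later k T first≡v second≡v i≤k col<col′ ,
  col<col′
  where open LeftmostTwoOccurrences occ

mainTheorem2 : (n k : ℕ) → 1 ≤ n → 2 * k ≤ 3 * n →
    (T : Tableau n 3) → IsFilling n k T →
    ∀ i → 1 ≤ i → i ≤ k → (2 * i ∸ 1 , 2 * i) ∈τ conj (tilde k T)
mainTheorem2 n k _ _ T ((_ , colStrict) , twice , _) i 1≤i i≤k =
  ∈τ-conj-tilde k T i 1≤i i≤k (leftmostTwoOccurrences T colStrict i (twice i 1≤i i≤k))
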